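{- The map $\alpha:B_n\to P_{2n}$ is surjective.
   Context: An $n$th-order chromatic diagram is a plane graph (loops and multiple edges allowed), up to isotopy, inside a rectangle with $n$ marked boundary points on the top side and $n$ on the bottom side, the graph lying in the interior except for attachment to boundary points, each boundary point having valency $1$. Inner vertices are non-boundary vertices; inner edges are edges with both endpoints inner. $B_n$ denotes the set of $n$th-order chromatic diagrams (up to isotopy) with no inner edges and all of whose inner vertices have valency at least $3$. Number the boundary points $1,\dots,2n$ counterclockwise starting at the bottom-left, and regard them as $2n$ points in this order on a circle. For $b\in B_n$, $\alpha(b)$ is the partition of $\{1,\dots,2n\}$ whose blocks are the sets of boundary points in a common connected component of $b$. $P_{2n}$ is the set of noncrossing partitions of these $2n$ circle points with no singleton blocks (noncrossing: joining points of each block cyclically by chords, chords from different blocks do not intersect); $\alpha$ takes values in $P_{2n}$. -}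

module Defs where

open import Data.Nat using (ℕ; zero; suc; _+_; _*_)
open import Data.Fin using (Fin; toℕ; _<_)
open import Data.Product using (Σ; ∃; ∃-syntax; _×_; _,_)
open import Data.Sum using (_⊎_)
open import Relation.Nullary using (¬_)
open import Relation.Binary.PropositionalEquality using (_≡_; _≢_)
open import Relation.Binary.Construct.Closure.ReflexiveTransitive using (Star)
open import Relation.Binary.Structures using (IsEquivalence)
open import Relation.Binary.Definitions using (Decidable)
open import Function.Bundles using (_⇔_)
open import Function.Definitions using (Injective)

-- Combinatorial maps (rotation systems) encode graphs embedded in an
-- oriented surface.  Darts = half-edges, σ = rotation around vertices
-- (a permutation), ι = fixed-point-free involution pairing the two
-- halves of each edge.  Vertices = σ-orbits, edges = ι-orbits,
-- faces = orbits of φ = σ ∘ ι.  Loops and multiple edges are allowed.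

record CMap : Set where
  field
    darts  : ℕ
    σ      : Fin darts → Fin darts
    σ⁻¹    : Fin darts → Fin darts
    σ-inv₁ : ∀ x → σ (σ⁻¹ x) ≡ x
    σ-inv₂ : ∀ x → σ⁻¹ (σ x) ≡ x
    ι      : Fin darts → Fin darts
    ι-invol : ∀ x → ι (ι x) ≡ x
    ι-free  : ∀ x → ι x ≢ x

iter : {A : Set} → (A → A) → ℕ → A → A
iter f zero    x = x
iter f (suc k) x = f (iter f k x)

SameOrbit : {m : ℕ} → (Fin m → Fin m) → Fin m → Fin m → Set
SameOrbit f x y = ∃[ k ] iter f k x ≡ y

NumClasses : {m : ℕ} → (Fin m → Fin m → Set) → ℕ → Set
NumClasses {m} R c =
  Σ (Fin m → Fin c) λ cls →
    (∀ v → ∃[ x ] cls x ≡ v) × (∀ x y → (cls x ≡ cls y) ⇔ R x y)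

module _ (M : CMap) where
  open CMap M

  φ : Fin darts → Fin darts
  φ x = σ (ι x)

  MapAdj : Fin darts → Fin darts → Set
  MapAdj x y = (y ≡ σ x) ⊎ (y ≡ ι x)

  MapConnected : Fin darts → Fin darts → Set
  MapConnected = Star MapAdj

  -- Every connected component is embedded in a sphere:
  -- V - E + F = 2 C, with E = darts / 2, i.e. 2V + 2F = darts + 4C.
  Planar : Set
  Planar = ∃[ V ] ∃[ F ] ∃[ C ]
    NumClasses (SameOrbit σ) V × NumClasses (SameOrbit φ) F ×
    NumClasses MapConnected C × (2 * V + 2 * F ≡ darts + 4 * C)

CyclicSucc : {k : ℕ} → Fin k → Fin k → Set
CyclicSucc {k} i j = (suc (toℕ i) ≡ toℕ j) ⊎ ((suc (toℕ i) ≡ k) × (toℕ j ≡ 0))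

-- A plane graph in the rectangle with 2n boundary points is encoded as a
-- planar map on the sphere obtained by collapsing the outside of the
-- rectangle to a single extra vertex ∞: the edge at boundary point i
-- becomes a dart  bd i  at ∞, and the rotation at ∞ lists the boundary
-- points in their counterclockwise order 1,…,2n.

record BDiagram (n : ℕ) : Set where
  field
    cmap  : CMap
  open CMap cmap
  field
    bd     : Fin (2 * n) → Fin darts
    bd-inj : Injective _≡_ _≡_ bd
    bd-rot : ∀ i j → CyclicSucc i j → σ (bd i) ≡ bd j
    planar : Planar cmap
  Inner : Fin darts → Set
  Inner x = ¬ (∃[ i ] bd i ≡ x)
  field
    noInnerEdge : ∀ x → Inner x → ¬ Inner (ι x)
    valency≥3   : ∀ x → Inner x → (σ x ≢ x) × (σ (σ x) ≢ x)

  -- adjacency in the diagram itself (boundary points are separate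
  -- vertices of valency 1: no rotation step at ∞)
  DiagAdj : Fin darts → Fin darts → Set
  DiagAdj x y = (y ≡ ι x) ⊎ (Inner x × (y ≡ σ x))

  α : Fin (2 * n) → Fin (2 * n) → Set
  α i j = Star DiagAdj (bd i) (bd j)

NoSingletons : {k : ℕ} → (Fin k → Fin k → Set) → Set
NoSingletons {k} R = ∀ i → ∃[ j ] (i ≢ j × R i j)

-- two different blocks never interleave (equivalently, the chords
-- joining each block cyclically do not cross)
Noncrossing : {k : ℕ} → (Fin k → Fin k → Set) → Set
Noncrossing {k} R = ∀ a b c d → a < b → b < c → c < d → R a c → R b d → R a b

record IsP (k : ℕ) (R : Fin k → Fin k → Set) : Set where
  field
    isEquiv     : IsEquivalence R
    dec         : Decidable R
    noSingleton : NoSingletons R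
    noncrossing : Noncrossing R

-- A block of two points becomes an edge joining them, and a block of k ≥ 3 points becomes an
-- inner vertex joined to each of its points, the rotation at that vertex following the block in
-- cyclic order.  Closing the rectangle by a vertex at infinity turns the diagram into a
-- combinatorial map, and planarity is checked by Euler's formula: the vertices are ∞ and one per
-- big block, and the faces are the outer face and one per arc joining cyclically consecutive points
-- of a block, the face of a gap between boundary points being that of the innermost arc spanning it.
-- Noncrossingness is what makes this face assignment consistent along φ = σ ∘ ι.  Since every
-- point starts or ends an arc, and does both exactly when it is interior to its block,
-- 2 (#big blocks) + 2 (#arcs) = #points + #inner darts, which is Euler's formula.

module Submission where

open import Defs
open import Data.Nat as ℕ using (ℕ; zero; suc; _+_; _*_)
import Data.Nat.Properties as ℕ
open import Data.Nat.Tactic.RingSolver using (solve-∀)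
open import Data.Fin as Fin using (Fin; zero; suc; toℕ; _<_; _↑ˡ_; _↑ʳ_; splitAt)
import Data.Fin.Properties as Fin
import Data.Fin.Permutation as Perm
open import Data.Maybe using (Maybe; just; nothing)
open import Data.Product using (Σ; ∃; ∃-syntax; _×_; _,_; proj₁; proj₂)
open import Data.Sum using (_⊎_; inj₁; inj₂; [_,_]′)
open import Data.Empty using (⊥-elim; ⊥-elim-irr)
open import Function.Base using (_∘_)
open import Function.Bundles using (_⇔_; mk⇔; Equivalence)
open import Relation.Nullary using (¬_; Dec; yes; no)
open import Relation.Nullary.Decidable using (_×-dec_; ¬?)
open import Relation.Unary using (Decidable)
open import Relation.Binary.Definitions using (tri<; tri≈; tri>)
open import Relation.Binary.Structures using (IsEquivalence)
open import Relation.Binary.Construct.Closure.ReflexiveTransitive using (Star; ε; _◅_; _◅◅_)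
open import Relation.Binary.PropositionalEquality using (_≡_; _≢_; refl; sym; trans; cong; cong₂; subst; subst₂; module ≡-Reasoning)
import Algebra.Properties.CommutativeMonoid.Sum ℕ.+-0-commutativeMonoid as Σℕ
open Σℕ using (sum)

-- Iterates and orbits

module _ {A : Set} (f : A → A) where

  iter-+ : ∀ m n x → iter f (m + n) x ≡ iter f m (iter f n x)
  iter-+ zero    n x = refl
  iter-+ (suc m) n x = cong f (iter-+ m n x)

  iter-invariant : ∀ {B : Set} (c : A → B) → (∀ x → c (f x) ≡ c x) → ∀ m x → c (iter f m x) ≡ c x
  iter-invariant c inv zero    x = refl
  iter-invariant c inv (suc m) x = trans (inv (iter f m x)) (iter-invariant c inv m x)

  iter-injective : (∀ {x y} → f x ≡ f y → x ≡ y) → ∀ m {x y} → iter f m x ≡ iter f m y → x ≡ y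
  iter-injective inj zero    e = e
  iter-injective inj (suc m) e = iter-injective inj m (inj e)

  iter-periodic : ∀ {p x} → iter f p x ≡ x → ∀ m → iter f (m * p) x ≡ x
  iter-periodic         fp zero    = refl
  iter-periodic {p} {x} fp (suc m) = trans (iter-+ p (m * p) x) (trans (cong (iter f p) (iter-periodic fp m)) fp)

iter-natural : ∀ {A B : Set} (f : A → A) (g : B → B) (h : B → A) → (∀ y → f (h y) ≡ h (g y)) →
               ∀ m y → iter f m (h y) ≡ h (iter g m y)
iter-natural f g h comm zero    y = refl
iter-natural f g h comm (suc m) y = trans (cong f (iter-natural f g h comm m y)) (comm (iter g m y))

SameOrbit-trans : ∀ {d} {f : Fin d → Fin d} {x y z} → SameOrbit f x y → SameOrbit f y z → SameOrbit f x z
SameOrbit-trans {f = f} {x} (m , refl) (n , refl) = n + m , iter-+ f n m x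

module _ {d : ℕ} (f : Fin d → Fin d) (f-injective : ∀ {x y} → f x ≡ f y → x ≡ y) where

  iter-period : ∀ x → ∃[ t ] iter f (suc t) x ≡ x
  iter-period x with Fin.pigeonhole (ℕ.n<1+n d) (λ i → iter f (toℕ i) x)
  ... | i , j , i<j , fi≡fj = t , iter-injective f f-injective (toℕ i) (begin
    iter f (toℕ i) (iter f (suc t) x) ≡⟨ iter-+ f (toℕ i) (suc t) x ⟨
    iter f (toℕ i + suc t) x          ≡⟨ cong (λ k → iter f k x) i+1+t≡j ⟩
    iter f (toℕ j) x                  ≡⟨ fi≡fj ⟨
    iter f (toℕ i) x                  ∎)
    where
    open ≡-Reasoning
    t = toℕ j ℕ.∸ suc (toℕ i)
    i+1+t≡j : toℕ i + suc t ≡ toℕ j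
    i+1+t≡j = trans (ℕ.+-suc (toℕ i) t) (ℕ.m+[n∸m]≡n i<j)

  SameOrbit-sym : ∀ {x y} → SameOrbit f x y → SameOrbit f y x
  SameOrbit-sym {x} (k , refl) with iter-period x
  ... | t , period = k * t , (begin
    iter f (k * t) (iter f k x) ≡⟨ iter-+ f (k * t) k x ⟨
    iter f (k * t + k) x        ≡⟨ cong (λ n → iter f n x) (trans (ℕ.+-comm (k * t) k) (sym (ℕ.*-suc k t))) ⟩
    iter f (k * suc t) x        ≡⟨ iter-periodic f period k ⟩
    x                           ∎)
    where open ≡-Reasoning

  numClasses-SameOrbit : ∀ {c} (label : Fin d → Fin c) (rep : Fin c → Fin d) →
    (∀ v → label (rep v) ≡ v) → (∀ x → label (f x) ≡ label x) →
    (∀ x → SameOrbit f x (rep (label x))) → NumClasses (SameOrbit f) c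
  numClasses-SameOrbit label rep label-rep invariant reaches =
    label , (λ v → rep v , label-rep v) , λ x y → mk⇔ (sameLabel⇒SameOrbit x y) (SameOrbit⇒sameLabel x y)
    where
    sameLabel⇒SameOrbit : ∀ x y → label x ≡ label y → SameOrbit f x y
    sameLabel⇒SameOrbit x y eq = SameOrbit-trans (reaches x)
      (subst (λ v → SameOrbit f (rep v) y) (sym eq) (SameOrbit-sym (reaches y)))
    SameOrbit⇒sameLabel : ∀ x y → SameOrbit f x y → label x ≡ label y
    SameOrbit⇒sameLabel x _ (k , refl) = sym (iter-invariant f label invariant k x)

-- Least elements, counting and enumeration on Fin n

≢∧≮⇒> : ∀ {n} {a b : Fin n} → a ≢ b → ¬ a < b → b < a
≢∧≮⇒> a≢b a≮b = ℕ.≤∧≢⇒< (ℕ.≮⇒≥ a≮b) (a≢b ∘ sym ∘ Fin.toℕ-injective)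

Least Greatest : ∀ {n} → (Fin n → Set) → Fin n → Set
Least    P b = P b × (∀ c → c < b → ¬ P c)
Greatest P b = P b × (∀ c → b < c → ¬ P c)

least? : ∀ {n} {P : Fin n → Set} → Decidable P → ∃ (Least P) ⊎ (∀ b → ¬ P b)
least? {zero}  P? = inj₂ λ ()
least? {suc n} P? with P? zero | least? (P? ∘ suc)
... | yes p₀ | _                      = inj₁ (zero , p₀ , λ _ ())
... | no ¬p₀ | inj₁ (b , pb , least)  = inj₁ (suc b , pb , λ { zero _ → ¬p₀ ; (suc c) (ℕ.s≤s c<b) → least c c<b })
... | no ¬p₀ | inj₂ none              = inj₂ λ { zero → ¬p₀ ; (suc b) → none b }

greatest? : ∀ {n} {P : Fin n → Set} → Decidable P → ∃ (Greatest P) ⊎ (∀ b → ¬ P b)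
greatest? {zero}  P? = inj₂ λ ()
greatest? {suc n} P? with greatest? (P? ∘ suc) | P? zero
... | inj₁ (b , pb , greatest) | _      = inj₁ (suc b , pb , λ { zero () ; (suc c) (ℕ.s≤s b<c) → greatest c b<c })
... | inj₂ none                | yes p₀ = inj₁ (zero , p₀ , λ { zero () ; (suc c) _ → none c })
... | inj₂ none                | no ¬p₀ = inj₂ λ { zero → ¬p₀ ; (suc b) → none b }

Least-unique : ∀ {n} {P Q : Fin n → Set} {a b} → (∀ x → P x → Q x) → (∀ x → Q x → P x) →
               Least P a → Least Q b → a ≡ b
Least-unique {a = a} {b} P⊆Q Q⊆P (pa , least-a) (qb , least-b) with Fin.<-cmp a b
... | tri< a<b _ _ = ⊥-elim (least-b a a<b (P⊆Q a pa))
... | tri≈ _ a≡b _ = a≡b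
... | tri> _ _ b<a = ⊥-elim (least-a b b<a (Q⊆P b qb))

minimum? : ∀ {n} {P : Fin n → Set} → Decidable P → Maybe (Fin n)
minimum? P? with least? P?
... | inj₁ (b , _) = just b
... | inj₂ _       = nothing

minimum?-just : ∀ {n} {P : Fin n → Set} (P? : Decidable P) {b} → Least P b → minimum? P? ≡ just b
minimum?-just P? least-b with least? P?
... | inj₁ (a , least-a) = cong just (Least-unique (λ _ p → p) (λ _ p → p) least-a least-b)
... | inj₂ none          = ⊥-elim (none _ (proj₁ least-b))

minimum?-nothing : ∀ {n} {P : Fin n → Set} (P? : Decidable P) → (∀ b → ¬ P b) → minimum? P? ≡ nothing
minimum?-nothing P? none with least? P?
... | inj₁ (a , pa , _) = ⊥-elim (none a pa)
... | inj₂ _            = refl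

minimum?-cong : ∀ {n} {P Q : Fin n → Set} (P? : Decidable P) (Q? : Decidable Q) →
                (∀ x → P x → Q x) → (∀ x → Q x → P x) → minimum? P? ≡ minimum? Q?
minimum?-cong P? Q? P⊆Q Q⊆P with least? Q?
... | inj₁ (b , qb , least-b) = minimum?-just P? (Q⊆P b qb , λ c c<b pc → least-b c c<b (P⊆Q c pc))
... | inj₂ none               = minimum?-nothing P? (λ b pb → none b (P⊆Q b pb))

indicator : ∀ {A : Set} → Dec A → ℕ
indicator (yes _) = 1
indicator (no _)  = 0

indicator-yes : ∀ {A : Set} → A → (d : Dec A) → indicator d ≡ 1
indicator-yes a (yes _) = refl
indicator-yes a (no ¬a) = ⊥-elim (¬a a)

indicator-no : ∀ {A : Set} → ¬ A → (d : Dec A) → indicator d ≡ 0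
indicator-no ¬a (yes a) = ⊥-elim (¬a a)
indicator-no ¬a (no _)  = refl

indicator-cong : ∀ {A B : Set} → A ⇔ B → (d : Dec A) (e : Dec B) → indicator d ≡ indicator e
indicator-cong A⇔B (yes a) e = sym (indicator-yes (Equivalence.to A⇔B a) e)
indicator-cong A⇔B (no ¬a) e = sym (indicator-no (¬a ∘ Equivalence.from A⇔B) e)

+-cong₄ : ∀ {a b c d a′ b′ c′ d′} → a ≡ a′ → b ≡ b′ → c ≡ c′ → d ≡ d′ →
          (a + b) + (c + d) ≡ (a′ + b′) + (c′ + d′)
+-cong₄ refl refl refl refl = refl

count : ∀ {n} {P : Fin n → Set} → Decidable P → ℕ
count P? = sum (indicator ∘ P?)

-- element enumerates the points satisfying P in increasing order; index is its inverse.
index : ∀ {n} {P : Fin n → Set} (P? : Decidable P) (i : Fin n) → .(P i) → Fin (count P?)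
index {suc n} P? i       pi with P? zero
index {suc n} P? zero    pi | yes _  = zero
index {suc n} P? zero    pi | no ¬p₀ = ⊥-elim-irr (¬p₀ pi)
index {suc n} P? (suc i) pi | yes _  = suc (index (P? ∘ suc) i pi)
index {suc n} P? (suc i) pi | no _   = index (P? ∘ suc) i pi

element : ∀ {n} {P : Fin n → Set} (P? : Decidable P) → Fin (count P?) → Fin n
element {suc n} P? v       with P? zero
element {suc n} P? zero    | yes _ = zero
element {suc n} P? (suc v) | yes _ = suc (element (P? ∘ suc) v)
element {suc n} P? v       | no _  = suc (element (P? ∘ suc) v)

element-satisfies : ∀ {n} {P : Fin n → Set} (P? : Decidable P) v → P (element P? v)
element-satisfies {suc n} P? v       with P? zero
element-satisfies {suc n} P? zero    | yes p₀ = p₀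
element-satisfies {suc n} P? (suc v) | yes _  = element-satisfies (P? ∘ suc) v
element-satisfies {suc n} P? v       | no _   = element-satisfies (P? ∘ suc) v

element-index : ∀ {n} {P : Fin n → Set} (P? : Decidable P) i .(pi : P i) → element P? (index P? i pi) ≡ i
element-index {suc n} P? i       pi with P? zero
element-index {suc n} P? zero    pi | yes _  = refl
element-index {suc n} P? zero    pi | no ¬p₀ = ⊥-elim-irr (¬p₀ pi)
element-index {suc n} P? (suc i) pi | yes _  = cong suc (element-index (P? ∘ suc) i pi)
element-index {suc n} P? (suc i) pi | no _   = cong suc (element-index (P? ∘ suc) i pi)

index-element : ∀ {n} {P : Fin n → Set} (P? : Decidable P) v .(pv : P (element P? v)) → index P? (element P? v) pv ≡ v
index-element {suc n} P? v       pv with P? zero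
index-element {suc n} P? zero    pv | yes _ = refl
index-element {suc n} P? (suc v) pv | yes _ = cong suc (index-element (P? ∘ suc) v pv)
index-element {suc n} P? v       pv | no _  = index-element (P? ∘ suc) v pv

index-cong : ∀ {n} {P : Fin n → Set} (P? : Decidable P) {i j} .{pi : P i} .{pj : P j} → i ≡ j → index P? i pi ≡ index P? j pj
index-cong P? refl = refl

count-permute : ∀ {n} {P : Fin n → Set} (P? : Decidable P) (π : Perm.Permutation n n) →
                count P? ≡ sum (λ i → indicator (P? (π Perm.⟨$⟩ʳ i)))
count-permute P? π = Σℕ.sum-permute (indicator ∘ P?) π

-- The cyclic successor on Fin (suc m)

opaque
  cyclicSucc : ∀ {m} → Fin (suc m) → Fin (suc m)
  cyclicSucc {m} i with m ℕ.≟ toℕ i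
  ... | yes _  = zero
  ... | no m≢i = suc (Fin.lower₁ i m≢i)

  cyclicSucc-CyclicSucc : ∀ {m} (i : Fin (suc m)) → CyclicSucc i (cyclicSucc i)
  cyclicSucc-CyclicSucc {m} i with m ℕ.≟ toℕ i
  ... | yes m≡i = inj₂ (cong suc (sym m≡i) , refl)
  ... | no m≢i  = inj₁ (cong suc (sym (Fin.toℕ-lower₁ i m≢i)))

CyclicSucc-functional : ∀ {k} {i j j′ : Fin k} → CyclicSucc i j → CyclicSucc i j′ → j ≡ j′
CyclicSucc-functional           (inj₁ e)       (inj₁ e′)       = Fin.toℕ-injective (trans (sym e) e′)
CyclicSucc-functional {j = j}   (inj₁ e)       (inj₂ (e′ , _)) = ⊥-elim (ℕ.<-irrefl (trans (sym e) e′) (Fin.toℕ<n j))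
CyclicSucc-functional {j′ = j′} (inj₂ (e , _)) (inj₁ e′)       = ⊥-elim (ℕ.<-irrefl (trans (sym e′) e) (Fin.toℕ<n j′))
CyclicSucc-functional           (inj₂ (_ , z)) (inj₂ (_ , z′)) = Fin.toℕ-injective (trans z (sym z′))

CyclicSucc⇒cyclicSucc : ∀ {m} {i j : Fin (suc m)} → CyclicSucc i j → cyclicSucc i ≡ j
CyclicSucc⇒cyclicSucc {i = i} = CyclicSucc-functional (cyclicSucc-CyclicSucc i)

cyclicPred : ∀ {m} → Fin (suc m) → Fin (suc m)
cyclicPred {m} zero    = Fin.fromℕ m
cyclicPred     (suc j) = Fin.inject₁ j

cyclicSucc-cyclicPred : ∀ {m} (j : Fin (suc m)) → cyclicSucc (cyclicPred j) ≡ j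
cyclicSucc-cyclicPred {m} zero = CyclicSucc⇒cyclicSucc (inj₂ (cong suc (Fin.toℕ-fromℕ m) , refl))
cyclicSucc-cyclicPred (suc j)  = CyclicSucc⇒cyclicSucc (inj₁ (cong suc (Fin.toℕ-inject₁ j)))

cyclicPred-cyclicSucc : ∀ {m} (i : Fin (suc m)) → cyclicPred (cyclicSucc i) ≡ i
cyclicPred-cyclicSucc {m} i with cyclicSucc i | cyclicSucc-CyclicSucc i
... | zero  | inj₂ (1+i≡1+m , _) = Fin.toℕ-injective (trans (Fin.toℕ-fromℕ m) (ℕ.suc-injective (sym 1+i≡1+m)))
... | suc j | inj₁ 1+i≡1+j      = Fin.toℕ-injective (trans (Fin.toℕ-inject₁ j) (ℕ.suc-injective (sym 1+i≡1+j)))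

iter-cyclicSucc-zero : ∀ {m} (j : Fin (suc m)) → iter cyclicSucc (toℕ j) zero ≡ j
iter-cyclicSucc-zero j = byValue (toℕ j) j refl
  where
  byValue : ∀ {m} t (j : Fin (suc m)) → toℕ j ≡ t → iter cyclicSucc t zero ≡ j
  byValue zero    zero    _ = refl
  byValue (suc t) (suc j) e = trans (cong cyclicSucc (byValue t (Fin.inject₁ j) (trans (Fin.toℕ-inject₁ j) (ℕ.suc-injective e))))
                                    (CyclicSucc⇒cyclicSucc (inj₁ (cong suc (Fin.toℕ-inject₁ j))))

SameOrbit-σ⇒MapConnected : ∀ (M : CMap) {x y} → SameOrbit (CMap.σ M) x y → MapConnected M x y
SameOrbit-σ⇒MapConnected M (zero  , refl) = ε
SameOrbit-σ⇒MapConnected M {x} (suc n , refl) = SameOrbit-σ⇒MapConnected M {x} (n , refl) ◅◅ (inj₁ refl ◅ ε)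

-- Blocks, arcs and faces of a noncrossing partition

module NoncrossingPartition {M : ℕ} (R : Fin (suc M) → Fin (suc M) → Set) (isP : IsP (suc M) R) where

  open IsP isP renaming (dec to R?)
  open IsEquivalence isEquiv renaming (refl to R-refl; sym to R-sym; trans to R-trans)

  N : ℕ
  N = suc M

  PrevBelow PrevWraps NextAbove NextWraps : Fin N → Fin N → Set
  PrevBelow i x = x < i × R x i × (∀ y → x < y → y < i → ¬ R y i)
  PrevWraps i x = i < x × R x i × (∀ y → y < i → ¬ R y i) × (∀ y → x < y → ¬ R y i)
  NextAbove i x = i < x × R i x × (∀ y → i < y → y < x → ¬ R i y)
  NextWraps i x = x < i × R i x × (∀ y → i < y → ¬ R i y) × (∀ y → y < x → ¬ R i y)

  private
    Below? : ∀ i → Decidable (λ j → j < i × R j i)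
    Below? i j = (j Fin.<? i) ×-dec R? j i

    Above? : ∀ i → Decidable (λ j → i < j × R i j)
    Above? i j = (i Fin.<? j) ×-dec R? i j

  -- prev and next walk cyclically around a block; the third clauses are unreachable since R i i.
  opaque
    prev : Fin N → Fin N
    prev i with greatest? (Below? i) | greatest? (R? i)
    ... | inj₁ (j , _) | _            = j
    ... | inj₂ _       | inj₁ (b , _) = b
    ... | inj₂ _       | inj₂ _       = i

    prev-spec : ∀ i → PrevBelow i (prev i) ⊎ PrevWraps i (prev i)
    prev-spec i with greatest? (Below? i) | greatest? (R? i)
    ... | inj₁ (j , (j<i , Rji) , gap) | _ = inj₁ (j<i , Rji , λ y j<y y<i Ryi → gap y j<y (y<i , Ryi))
    ... | inj₂ none | inj₁ (b , Rib , top) =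
      inj₂ (i<b , R-sym Rib , (λ y y<i Ryi → none y (y<i , Ryi)) , λ y b<y Ryi → top y b<y (R-sym Ryi))
      where
      i<b : i < b
      i<b with noSingleton i
      ... | j , i≢j , Rij with Fin.<-cmp i j
      ...   | tri< i<j _ _ = ℕ.<-≤-trans i<j (ℕ.≮⇒≥ λ b<j → top j b<j Rij)
      ...   | tri≈ _ i≡j _ = ⊥-elim (i≢j i≡j)
      ...   | tri> _ _ j<i = ⊥-elim (none j (j<i , R-sym Rij))
    ... | inj₂ _ | inj₂ none = ⊥-elim (none i R-refl)

    next : Fin N → Fin N
    next i with least? (Above? i) | least? (R? i)
    ... | inj₁ (j , _) | _            = j
    ... | inj₂ _       | inj₁ (b , _) = b
    ... | inj₂ _       | inj₂ _       = i

    next-spec : ∀ i → NextAbove i (next i) ⊎ NextWraps i (next i)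
    next-spec i with least? (Above? i) | least? (R? i)
    ... | inj₁ (j , (i<j , Rij) , gap) | _ = inj₁ (i<j , Rij , λ y i<y y<j Riy → gap y y<j (i<y , Riy))
    ... | inj₂ none | inj₁ (b , Rib , bottom) =
      inj₂ (b<i , Rib , (λ y i<y Riy → none y (i<y , Riy)) , bottom)
      where
      b<i : b < i
      b<i with noSingleton i
      ... | j , i≢j , Rij with Fin.<-cmp i j
      ...   | tri< i<j _ _ = ⊥-elim (none j (i<j , Rij))
      ...   | tri≈ _ i≡j _ = ⊥-elim (i≢j i≡j)
      ...   | tri> _ _ j<i = ℕ.≤-<-trans (ℕ.≮⇒≥ λ j<b → bottom j j<b Rij) j<i
    ... | inj₂ _ | inj₂ none = ⊥-elim (none i R-refl)

  R-prev : ∀ i → R (prev i) i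
  R-prev i with prev-spec i
  ... | inj₁ (_ , r , _) = r
  ... | inj₂ (_ , r , _) = r

  prev≢ : ∀ i → prev i ≢ i
  prev≢ i e with prev-spec i
  ... | inj₁ (lt , _) = Fin.<-irrefl e lt
  ... | inj₂ (lt , _) = Fin.<-irrefl (sym e) lt

  prev-next : ∀ i → prev (next i) ≡ i
  prev-next i with next-spec i | prev-spec (next i)
  ... | inj₁ (i<n , Rin , gapₙ) | inj₁ (pn<n , Rpn , gapₚ) with Fin.<-cmp (prev (next i)) i
  ...   | tri< pn<i _ _ = ⊥-elim (gapₚ i pn<i i<n Rin)
  ...   | tri≈ _ e _    = e
  ...   | tri> _ _ i<pn = ⊥-elim (gapₙ (prev (next i)) i<pn pn<n (R-trans Rin (R-sym Rpn)))
  prev-next i | inj₁ (i<n , Rin , _) | inj₂ (_ , _ , below , _) = ⊥-elim (below i i<n Rin)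
  prev-next i | inj₂ (_ , Rin , _ , below) | inj₁ (pn<n , Rpn , _) = ⊥-elim (below (prev (next i)) pn<n (R-trans Rin (R-sym Rpn)))
  prev-next i | inj₂ (_ , Rin , above , _) | inj₂ (_ , Rpn , _ , aboveₚ) with Fin.<-cmp (prev (next i)) i
  ...   | tri< pn<i _ _ = ⊥-elim (aboveₚ i pn<i Rin)
  ...   | tri≈ _ e _    = e
  ...   | tri> _ _ i<pn = ⊥-elim (above (prev (next i)) i<pn (R-trans Rin (R-sym Rpn)))

  next-prev : ∀ i → next (prev i) ≡ i
  next-prev i with prev-spec i | next-spec (prev i)
  ... | inj₁ (p<i , Rpi , gapₚ) | inj₁ (p<np , Rpnp , gapₙ) with Fin.<-cmp (next (prev i)) i
  ...   | tri< np<i _ _ = ⊥-elim (gapₚ (next (prev i)) p<np np<i (R-trans (R-sym Rpnp) Rpi))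
  ...   | tri≈ _ e _    = e
  ...   | tri> _ _ i<np = ⊥-elim (gapₙ i p<i i<np Rpi)
  next-prev i | inj₁ (p<i , Rpi , _) | inj₂ (_ , _ , above , _) = ⊥-elim (above i p<i Rpi)
  next-prev i | inj₂ (_ , Rpi , _ , above) | inj₁ (p<np , Rpnp , _) = ⊥-elim (above (next (prev i)) p<np (R-trans (R-sym Rpnp) Rpi))
  next-prev i | inj₂ (_ , Rpi , below , _) | inj₂ (_ , Rpnp , _ , belowₙ) with Fin.<-cmp (next (prev i)) i
  ...   | tri< np<i _ _ = ⊥-elim (below (next (prev i)) np<i (R-trans (R-sym Rpnp) Rpi))
  ...   | tri≈ _ e _    = e
  ...   | tri> _ _ i<np = ⊥-elim (belowₙ i i<np Rpi)

  prev-injective : ∀ {a b} → prev a ≡ prev b → a ≡ b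
  prev-injective {a} {b} e = trans (sym (next-prev a)) (trans (cong next e) (next-prev b))

  -- Walking down with prev from i reaches every j ≤ i of the block, then wraps to the maximum.
  prev-orbit-block : ∀ {i j} → R i j → SameOrbit prev i j
  prev-orbit-block {i} {j} Rij = byOrder (i Fin.<? j)
    where
    downward : ∀ k i → toℕ i ℕ.< k → R i j → ¬ i < j → SameOrbit prev i j
    downward (suc k) i i<k Rij i≮j with i Fin.≟ j
    ... | yes i≡j = 0 , i≡j
    ... | no i≢j with prev-spec i
    ...   | inj₂ (_ , _ , below , _) = ⊥-elim (below j (≢∧≮⇒> i≢j i≮j) (R-sym Rij))
    ...   | inj₁ (qi<i , Rqii , gap) =
      SameOrbit-trans (1 , refl) (downward k (prev i) (ℕ.<-≤-trans qi<i (ℕ.≤-pred i<k)) (R-trans Rqii Rij)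
                                    (λ qi<j → gap j qi<j (≢∧≮⇒> i≢j i≮j) (R-sym Rij)))
    upward : ∀ k i → toℕ i ℕ.< k → R i j → i < j → SameOrbit prev i j
    upward (suc k) i i<k Rij i<j with prev-spec i
    ... | inj₁ (qi<i , Rqii , _) =
      SameOrbit-trans (1 , refl) (upward k (prev i) (ℕ.<-≤-trans qi<i (ℕ.≤-pred i<k)) (R-trans Rqii Rij) (Fin.<-trans qi<i i<j))
    ... | inj₂ (_ , Rqii , _ , above) =
      SameOrbit-trans (1 , refl) (downward (suc (toℕ (prev i))) (prev i) (ℕ.n<1+n _) (R-trans Rqii Rij) (λ qi<j → above j qi<j (R-sym Rij)))
    byOrder : Dec (i < j) → SameOrbit prev i j
    byOrder (yes i<j) = upward (suc (toℕ i)) i (ℕ.n<1+n _) Rij i<j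
    byOrder (no i≮j)  = downward (suc (toℕ i)) i (ℕ.n<1+n _) Rij i≮j

  -- Big i: the block of i has at least three elements.
  Big : Fin N → Set
  Big i = prev i ≢ next i

  Big? : Decidable Big
  Big? i = ¬? (prev i Fin.≟ next i)

  Big-prev : ∀ {i} → Big i → Big (prev i)
  Big-prev {i} big e = big (trans (sym (next-prev (prev i))) (cong next (trans e (next-prev i))))

  Big-prev⁻ : ∀ {i} → Big (prev i) → Big i
  Big-prev⁻ {i} big e = big (trans (cong prev e) (trans (prev-next i) (sym (next-prev i))))

  Big-next : ∀ {i} → Big i → Big (next i)
  Big-next {i} big = Big-prev⁻ (subst Big (sym (prev-next i)) big)

  Big-next⁻ : ∀ {i} → Big (next i) → Big i
  Big-next⁻ {i} big = subst Big (prev-next i) (Big-prev big)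

  Big-iter-prev : ∀ k {i} → Big i → Big (iter prev k i)
  Big-iter-prev zero    big = big
  Big-iter-prev (suc k) big = Big-prev (Big-iter-prev k big)

  prev-prev-small : ∀ {i} → ¬ Big i → prev (prev i) ≡ i
  prev-prev-small {i} small with prev i Fin.≟ next i
  ... | yes e = trans (cong prev e) (prev-next i)
  ... | no ne = ⊥-elim (small ne)

  blockMin : Fin N → Fin N
  blockMin i with least? (R? i)
  ... | inj₁ (b , _) = b
  ... | inj₂ _       = i

  blockMin-least : ∀ i → Least (R i) (blockMin i)
  blockMin-least i with least? (R? i)
  ... | inj₁ (_ , least) = least
  ... | inj₂ none        = ⊥-elim (none i R-refl)

  blockMin-cong : ∀ {i j} → R i j → blockMin i ≡ blockMin j
  blockMin-cong {i} {j} Rij = Least-unique (λ _ Rix → R-trans (R-sym Rij) Rix) (λ _ Rjx → R-trans Rij Rjx)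
                                           (blockMin-least i) (blockMin-least j)

  blockMin-self : ∀ {i} → (∀ y → y < i → ¬ R y i) → blockMin i ≡ i
  blockMin-self {i} below = Least-unique (λ _ r → r) (λ _ r → r) (blockMin-least i) (R-refl , λ y y<i Riy → below y y<i (R-sym Riy))

  BigBlockMin : Fin N → Set
  BigBlockMin i = Big i × i < prev i

  BigBlockMin? : Decidable BigBlockMin
  BigBlockMin? i = Big? i ×-dec (i Fin.<? prev i)

  BigBlockMin-blockMin : ∀ {i} → Big i → BigBlockMin (blockMin i)
  BigBlockMin-blockMin {i} big = Big-min , min<prev
    where
    min = blockMin i
    Rimin = proj₁ (blockMin-least i)
    Big-min : Big min
    Big-min with prev-orbit-block Rimin
    ... | k , e = subst Big e (Big-iter-prev k big)
    min<prev : min < prev min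
    min<prev with prev-spec min
    ... | inj₂ (lt , _) = lt
    ... | inj₁ (pm<m , Rpm , _) = ⊥-elim (proj₂ (blockMin-least i) (prev min) pm<m (R-trans Rimin (R-sym Rpm)))

  blockMin-BigBlockMin : ∀ {i} → BigBlockMin i → blockMin i ≡ i
  blockMin-BigBlockMin {i} (_ , i<prev) with prev-spec i
  ... | inj₁ (prev<i , _)         = ⊥-elim (Fin.<-asym prev<i i<prev)
  ... | inj₂ (_ , _ , below , _)  = blockMin-self below

  -- Each j with prev j < j closes an arc (prev j , j); these arcs bound the inner faces.
  ArcEnd : Fin N → Set
  ArcEnd i = prev i < i

  ArcEnd? : Decidable ArcEnd
  ArcEnd? i = prev i Fin.<? i

  -- The arc (prev b , b) spans the gap just before position g.
  Spans : ℕ → Fin N → Set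
  Spans g b = g ℕ.≤ toℕ b × toℕ (prev b) ℕ.< g

  Spans? : ∀ g → Decidable (Spans g)
  Spans? g b = (g ℕ.≤? toℕ b) ×-dec (toℕ (prev b) ℕ.<? g)

  -- The face containing the gap before g; nothing stands for the outer face.
  innermostArc : ℕ → Maybe (Fin N)
  innermostArc g = minimum? (Spans? g)

  innermostArc-ArcEnd : ∀ {j} → ArcEnd j → innermostArc (toℕ j) ≡ just j
  innermostArc-ArcEnd {j} prev<j = minimum?-just (Spans? (toℕ j)) ((ℕ.≤-refl , prev<j) , λ c c<j (j≤c , _) → ℕ.<⇒≱ c<j j≤c)

  innermostArc-zero : innermostArc 0 ≡ nothing
  innermostArc-zero = minimum?-nothing (Spans? 0) λ _ ()

  innermostArc-N : innermostArc N ≡ nothing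
  innermostArc-N = minimum?-nothing (Spans? N) λ b (N≤b , _) → ℕ.<⇒≱ (Fin.toℕ<n b) N≤b

  -- Noncrossing is used exactly here: the gap just after prev i lies in the same face as the gap before i.
  innermostArc-prev : ∀ i → innermostArc (suc (toℕ (prev i))) ≡ innermostArc (toℕ i)
  innermostArc-prev i with prev-spec i
  ... | inj₁ (prev<i , Rpi , gap) = trans (minimum?-just (Spans? _) ((prev<i , ℕ.n<1+n _) , innermost)) (sym (innermostArc-ArcEnd prev<i))
    where
    innermost : ∀ b → b < i → ¬ Spans (suc (toℕ (prev i))) b
    innermost b b<i (prev<b , pb≤pi) = gap b prev<b b<i (R-trans (R-sym (R-prev b)) (R-trans Rpb,pi (R-prev i)))
      where
      pb<pi : prev b < prev i
      pb<pi = ℕ.≤∧≢⇒< (ℕ.≤-pred pb≤pi) λ e → Fin.<-irrefl (prev-injective (Fin.toℕ-injective e)) b<i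
      Rpb,pi : R (prev b) (prev i)
      Rpb,pi = noncrossing (prev b) (prev i) b i pb<pi prev<b b<i (R-prev b) (R-prev i)
  ... | inj₂ (i<prev , Rpi , below , above) = minimum?-cong (Spans? _) (Spans? _) to from
    where
    to : ∀ b → Spans (suc (toℕ (prev i))) b → Spans (toℕ i) b
    to b (prev<b , pb≤pi) = ℕ.<⇒≤ (Fin.<-trans i<prev prev<b) , pb<i
      where
      ¬Rib : ¬ R i b
      ¬Rib Rib = above b prev<b (R-sym Rib)
      pb<i : prev b < i
      pb<i with Fin.<-cmp (prev b) i
      ... | tri< lt _ _ = lt
      ... | tri≈ _ e _  = ⊥-elim (¬Rib (subst (λ z → R z b) e (R-prev b)))
      ... | tri> _ _ i<pb with Fin.<-cmp (prev b) (prev i)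
      ...   | tri< pb<pi _ _ = ⊥-elim (¬Rib (R-trans (noncrossing i (prev b) (prev i) b i<pb pb<pi prev<b (R-sym Rpi) (R-prev b)) (R-prev b)))
      ...   | tri≈ _ e _     = ⊥-elim (¬Rib (R-trans (R-sym Rpi) (subst (λ z → R z b) e (R-prev b))))
      ...   | tri> _ _ pi<pb = ⊥-elim (ℕ.<⇒≱ pi<pb (ℕ.≤-pred pb≤pi))
    from : ∀ b → Spans (toℕ i) b → Spans (suc (toℕ (prev i))) b
    from b (i≤b , pb<i) = prev<b , ℕ.m<n⇒m<1+n (Fin.<-trans pb<i i<prev)
      where
      ¬Rpb,i : ¬ R (prev b) i
      ¬Rpb,i = below (prev b) pb<i
      prev<b : prev i < b
      prev<b with Fin.<-cmp (prev i) b
      ... | tri< lt _ _ = lt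
      ... | tri≈ _ e _  = ⊥-elim (¬Rpb,i (R-trans (R-prev b) (subst (λ z → R z i) e Rpi)))
      ... | tri> _ _ b<pi with Fin.<-cmp i b
      ...   | tri< i<b _ _ = ⊥-elim (¬Rpb,i (noncrossing (prev b) i b (prev i) pb<i i<b b<pi (R-prev b) (R-sym Rpi)))
      ...   | tri≈ _ e _   = ⊥-elim (Fin.<-asym pb<i (subst (λ z → i < prev z) e i<prev))
      ...   | tri> _ _ b<i = ⊥-elim (ℕ.<⇒≱ b<i i≤b)

  innermostArc-cyclicSucc : ∀ j → innermostArc (toℕ (cyclicSucc j)) ≡ innermostArc (suc (toℕ j))
  innermostArc-cyclicSucc j with cyclicSucc j | cyclicSucc-CyclicSucc j
  ... | _    | inj₁ e        = cong innermostArc (sym e)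
  ... | zero | inj₂ (e , _)  = trans innermostArc-zero (trans (sym innermostArc-N) (cong innermostArc (sym e)))

  BigBlockMax ArcStart : Fin N → Set
  BigBlockMax i = Big i × next i < i
  ArcStart    i = i < next i

  BigBlockMax? : Decidable BigBlockMax
  BigBlockMax? i = Big? i ×-dec (next i Fin.<? i)

  ArcStart? : Decidable ArcStart
  ArcStart? i = i Fin.<? next i

  #bigBlocks #arcs #bigPoints : ℕ
  #bigBlocks = count BigBlockMin?
  #arcs      = count ArcEnd?
  #bigPoints = count Big?

  private
    next-permutation : Perm.Permutation N N
    next-permutation = Perm.permutation next prev next-prev prev-next

    [_] : ∀ {A : Set} → Dec A → ℕ
    [_] = indicator

  #bigBlocks-by-max : #bigBlocks ≡ count BigBlockMax?
  #bigBlocks-by-max = trans (count-permute BigBlockMin? next-permutation) (Σℕ.sum-cong-≗ λ i →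
    indicator-cong (mk⇔ (λ (big , lt) → Big-next⁻ big , subst (next i <_) (prev-next i) lt)
                        (λ (big , lt) → Big-next big , subst (next i <_) (sym (prev-next i)) lt))
                   (BigBlockMin? (next i)) (BigBlockMax? i))

  #arcs-by-start : #arcs ≡ count ArcStart?
  #arcs-by-start = trans (count-permute ArcEnd? next-permutation) (Σℕ.sum-cong-≗ λ i →
    indicator-cong (mk⇔ (subst (_< next i) (prev-next i)) (subst (_< next i) (sym (prev-next i))))
                   (ArcEnd? (next i)) (ArcStart? i))

  -- Every point starts or ends an arc, and does both exactly when it is neither the minimum nor the maximum of its block.
  point-count : ∀ i → ([ BigBlockMin? i ] + [ BigBlockMax? i ]) + ([ ArcEnd? i ] + [ ArcStart? i ]) ≡ 1 + [ Big? i ]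
  point-count i with prev-spec i | next-spec i
  ... | inj₁ (p<i , _) | inj₁ (i<n , _) =
    trans (+-cong₄ (indicator-no (λ (_ , i<p) → Fin.<-asym p<i i<p) (BigBlockMin? i))
                (indicator-no (λ (_ , n<i) → Fin.<-asym n<i i<n) (BigBlockMax? i))
                (indicator-yes p<i (ArcEnd? i)) (indicator-yes i<n (ArcStart? i)))
          (cong suc (sym (indicator-yes (λ p≡n → Fin.<-asym (subst (_< i) p≡n p<i) i<n) (Big? i))))
  ... | inj₂ (i<p , _) | inj₁ (i<n , _) =
    trans (+-cong₄ (indicator-cong (mk⇔ proj₁ (_, i<p)) (BigBlockMin? i) (Big? i))
                (indicator-no (λ (_ , n<i) → Fin.<-asym n<i i<n) (BigBlockMax? i))
                (indicator-no (Fin.<-asym i<p) (ArcEnd? i)) (indicator-yes i<n (ArcStart? i)))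
          (trans (cong (_+ 1) (ℕ.+-identityʳ _)) (ℕ.+-comm _ 1))
  ... | inj₁ (p<i , _) | inj₂ (n<i , _) =
    trans (+-cong₄ (indicator-no (λ (_ , i<p) → Fin.<-asym p<i i<p) (BigBlockMin? i))
                (indicator-cong (mk⇔ proj₁ (_, n<i)) (BigBlockMax? i) (Big? i))
                (indicator-yes p<i (ArcEnd? i)) (indicator-no (Fin.<-asym n<i) (ArcStart? i)))
          (ℕ.+-comm _ 1)
  ... | inj₂ (_ , _ , below , _) | inj₂ (n<i , Rin , _) = ⊥-elim (below (next i) n<i (R-sym Rin))

  -- The Euler relation of the diagram, before adding the vertex at infinity and the outer face.
  count-identity : (#bigBlocks + #bigBlocks) + (#arcs + #arcs) ≡ N + #bigPoints
  count-identity = begin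
    (#bigBlocks + #bigBlocks) + (#arcs + #arcs)
      ≡⟨ cong₂ (λ a b → (#bigBlocks + a) + (#arcs + b)) #bigBlocks-by-max #arcs-by-start ⟩
    (#bigBlocks + count BigBlockMax?) + (#arcs + count ArcStart?)
      ≡⟨ cong₂ _+_ (Σℕ.∑-distrib-+ ([_] ∘ BigBlockMin?) ([_] ∘ BigBlockMax?))
                   (Σℕ.∑-distrib-+ ([_] ∘ ArcEnd?) ([_] ∘ ArcStart?)) ⟨
    sum (λ i → [ BigBlockMin? i ] + [ BigBlockMax? i ]) + sum (λ i → [ ArcEnd? i ] + [ ArcStart? i ])
      ≡⟨ Σℕ.∑-distrib-+ (λ i → [ BigBlockMin? i ] + [ BigBlockMax? i ]) (λ i → [ ArcEnd? i ] + [ ArcStart? i ]) ⟨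
    sum (λ i → ([ BigBlockMin? i ] + [ BigBlockMax? i ]) + ([ ArcEnd? i ] + [ ArcStart? i ]))
      ≡⟨ Σℕ.sum-cong-≗ point-count ⟩
    sum (λ i → 1 + [ Big? i ])
      ≡⟨ Σℕ.∑-distrib-+ (λ _ → 1) ([_] ∘ Big?) ⟩
    sum {N} (λ _ → 1) + #bigPoints
      ≡⟨ cong (_+ #bigPoints) (sum-ones N) ⟩
    N + #bigPoints ∎
    where
    open ≡-Reasoning
    sum-ones : ∀ n → sum {n} (λ _ → 1) ≡ n
    sum-ones zero    = refl
    sum-ones (suc n) = cong suc (sum-ones n)

-- The diagram of a noncrossing partition

module Darts (N K : ℕ) where

  boundary : Fin N → Fin (N + K)
  boundary i = i ↑ˡ K

  inner : Fin K → Fin (N + K)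
  inner k = N ↑ʳ k

  caseDart : ∀ {A : Set} → (Fin N → A) → (Fin K → A) → Fin (N + K) → A
  caseDart onBoundary onInner = [ onBoundary , onInner ]′ ∘ splitAt N

  caseDart-boundary : ∀ {A : Set} (f : Fin N → A) (g : Fin K → A) i → caseDart f g (boundary i) ≡ f i
  caseDart-boundary f g i = cong [ f , g ]′ (Fin.splitAt-↑ˡ N i K)

  caseDart-inner : ∀ {A : Set} (f : Fin N → A) (g : Fin K → A) k → caseDart f g (inner k) ≡ g k
  caseDart-inner f g k = cong [ f , g ]′ (Fin.splitAt-↑ʳ N K k)

  dart-elim : (P : Fin (N + K) → Set) → (∀ i → P (boundary i)) → (∀ k → P (inner k)) → ∀ x → P x
  dart-elim P onBoundary onInner x = subst P (Fin.join-splitAt N K x) (byPart (splitAt N x))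
    where
    byPart : ∀ s → P (Fin.join N K s)
    byPart (inj₁ i) = onBoundary i
    byPart (inj₂ k) = onInner k

  boundary-injective : ∀ {i j} → boundary i ≡ boundary j → i ≡ j
  boundary-injective = Fin.↑ˡ-injective K _ _

  inner-injective : ∀ {k l} → inner k ≡ inner l → k ≡ l
  inner-injective = Fin.↑ʳ-injective N _ _

  boundary≢inner : ∀ {i k} → boundary i ≢ inner k
  boundary≢inner {i} {k} e with trans (sym (Fin.splitAt-↑ˡ N i K)) (trans (cong (splitAt N) e) (Fin.splitAt-↑ʳ N K k))
  ... | ()

module Construction {M : ℕ} (R : Fin (suc M) → Fin (suc M) → Set) (isP : IsP (suc M) R) where

  open NoncrossingPartition R isP
  open IsP isP using (isEquiv)
  open IsEquivalence isEquiv renaming (refl to R-refl; sym to R-sym; trans to R-trans)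

  open Darts N #bigPoints public

  D : ℕ
  D = N + #bigPoints

  -- Each point of a big block carries one inner dart, at the inner vertex of its block.
  pointOf : Fin #bigPoints → Fin N
  pointOf = element Big?

  innerAt : (i : Fin N) → .(Big i) → Fin #bigPoints
  innerAt = index Big?

  Big-pointOf : ∀ k → Big (pointOf k)
  Big-pointOf = element-satisfies Big?

  innerAt-cong : ∀ {i j} .{bi : Big i} .{bj : Big j} → i ≡ j → innerAt i bi ≡ innerAt j bj
  innerAt-cong = index-cong Big?

  pointOf-innerAt : ∀ i .(big : Big i) → pointOf (innerAt i big) ≡ i
  pointOf-innerAt = element-index Big?

  innerAt-pointOf : ∀ k → innerAt (pointOf k) (Big-pointOf k) ≡ k
  innerAt-pointOf k = index-element Big? k (Big-pointOf k)

  -- A two-point block is a single edge between its boundary points.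
  ιBoundary : Fin N → Fin D
  ιBoundary i with Big? i
  ... | yes big = inner (innerAt i big)
  ... | no _    = boundary (prev i)

  σ σ⁻¹ ι : Fin D → Fin D
  σ   = caseDart (boundary ∘ cyclicSucc) λ k → inner (innerAt (prev (pointOf k)) (Big-prev (Big-pointOf k)))
  σ⁻¹ = caseDart (boundary ∘ cyclicPred) λ k → inner (innerAt (next (pointOf k)) (Big-next (Big-pointOf k)))
  ι   = caseDart ιBoundary (boundary ∘ pointOf)

  σ-boundary : ∀ i → σ (boundary i) ≡ boundary (cyclicSucc i)
  σ-boundary = caseDart-boundary _ _

  σ-inner : ∀ k → σ (inner k) ≡ inner (innerAt (prev (pointOf k)) (Big-prev (Big-pointOf k)))
  σ-inner = caseDart-inner _ _

  σ-innerAt : ∀ i .(bi : Big i) .(bpi : Big (prev i)) → σ (inner (innerAt i bi)) ≡ inner (innerAt (prev i) bpi)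
  σ-innerAt i bi bpi = trans (σ-inner _) (cong inner (innerAt-cong (cong prev (pointOf-innerAt i bi))))

  σ⁻¹-boundary : ∀ i → σ⁻¹ (boundary i) ≡ boundary (cyclicPred i)
  σ⁻¹-boundary = caseDart-boundary _ _

  σ⁻¹-inner : ∀ k → σ⁻¹ (inner k) ≡ inner (innerAt (next (pointOf k)) (Big-next (Big-pointOf k)))
  σ⁻¹-inner = caseDart-inner _ _

  σ⁻¹-innerAt : ∀ i .(bi : Big i) .(bni : Big (next i)) → σ⁻¹ (inner (innerAt i bi)) ≡ inner (innerAt (next i) bni)
  σ⁻¹-innerAt i bi bni = trans (σ⁻¹-inner _) (cong inner (innerAt-cong (cong next (pointOf-innerAt i bi))))

  ι-boundary-big : ∀ i .(big : Big i) → ι (boundary i) ≡ inner (innerAt i big)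
  ι-boundary-big i big = trans (caseDart-boundary _ _ i) (ιBoundary-big i big)
    where
    ιBoundary-big : ∀ i .(big : Big i) → ιBoundary i ≡ inner (innerAt i big)
    ιBoundary-big i big with Big? i
    ... | yes _ = refl
    ... | no small = ⊥-elim-irr (small big)

  ι-boundary-small : ∀ i → ¬ Big i → ι (boundary i) ≡ boundary (prev i)
  ι-boundary-small i small = trans (caseDart-boundary _ _ i) (ιBoundary-small i small)
    where
    ιBoundary-small : ∀ i → ¬ Big i → ιBoundary i ≡ boundary (prev i)
    ιBoundary-small i small with Big? i
    ... | yes big = ⊥-elim (small big)
    ... | no _    = refl

  ι-inner : ∀ k → ι (inner k) ≡ boundary (pointOf k)
  ι-inner = caseDart-inner _ _

  ι-innerAt : ∀ i .(big : Big i) → ι (inner (innerAt i big)) ≡ boundary i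
  ι-innerAt i big = trans (ι-inner _) (cong boundary (pointOf-innerAt i big))

  σ-σ⁻¹ : ∀ x → σ (σ⁻¹ x) ≡ x
  σ-σ⁻¹ = dart-elim _
    (λ i → trans (cong σ (σ⁻¹-boundary i)) (trans (σ-boundary (cyclicPred i)) (cong boundary (cyclicSucc-cyclicPred i))))
    (λ k → trans (cong σ (σ⁻¹-inner k)) (trans (σ-innerAt (next (pointOf k)) _ (Big-prev (Big-next (Big-pointOf k))))
              (cong inner (trans (innerAt-cong (prev-next (pointOf k))) (innerAt-pointOf k)))))

  σ⁻¹-σ : ∀ x → σ⁻¹ (σ x) ≡ x
  σ⁻¹-σ = dart-elim _
    (λ i → trans (cong σ⁻¹ (σ-boundary i)) (trans (σ⁻¹-boundary (cyclicSucc i)) (cong boundary (cyclicPred-cyclicSucc i))))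
    (λ k → trans (cong σ⁻¹ (σ-inner k)) (trans (σ⁻¹-innerAt (prev (pointOf k)) _ (Big-next (Big-prev (Big-pointOf k))))
              (cong inner (trans (innerAt-cong (next-prev (pointOf k))) (innerAt-pointOf k)))))

  ι-ι : ∀ x → ι (ι x) ≡ x
  ι-ι = dart-elim _ onBoundary
    (λ k → trans (cong ι (ι-inner k)) (trans (ι-boundary-big (pointOf k) (Big-pointOf k)) (cong inner (innerAt-pointOf k))))
    where
    onBoundary : ∀ i → ι (ι (boundary i)) ≡ boundary i
    onBoundary i with Big? i
    ... | yes big = trans (cong ι (ι-boundary-big i big)) (ι-innerAt i big)
    ... | no small = trans (cong ι (ι-boundary-small i small))
                     (trans (ι-boundary-small (prev i) (small ∘ Big-prev⁻)) (cong boundary (prev-prev-small small)))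

  ι-fixpoint-free : ∀ x → ι x ≢ x
  ι-fixpoint-free = dart-elim _ onBoundary (λ k e → boundary≢inner (trans (sym (ι-inner k)) e))
    where
    onBoundary : ∀ i → ι (boundary i) ≢ boundary i
    onBoundary i with Big? i
    ... | yes big = λ e → boundary≢inner (sym (trans (sym (ι-boundary-big i big)) e))
    ... | no small = λ e → prev≢ i (boundary-injective (trans (sym (ι-boundary-small i small)) e))

  diagramMap : CMap
  diagramMap = record { darts = D ; σ = σ ; σ⁻¹ = σ⁻¹ ; σ-inv₁ = σ-σ⁻¹ ; σ-inv₂ = σ⁻¹-σ
                      ; ι = ι ; ι-invol = ι-ι ; ι-free = ι-fixpoint-free }

  Inner : Fin D → Set
  Inner x = ¬ (∃[ i ] boundary i ≡ x)

  Inner-inner : ∀ k → Inner (inner k)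
  Inner-inner k (i , e) = boundary≢inner e

  boundary-CyclicSucc : ∀ i j → CyclicSucc i j → σ (boundary i) ≡ boundary j
  boundary-CyclicSucc i j succ = trans (σ-boundary i) (cong boundary (CyclicSucc⇒cyclicSucc succ))

  no-inner-edge : ∀ x → Inner x → ¬ Inner (ι x)
  no-inner-edge = dart-elim _ (λ i inner-i _ → inner-i (i , refl)) (λ k _ ¬boundary → ¬boundary (pointOf k , sym (ι-inner k)))

  -- Inner vertices sit on big blocks, so σ has no cycle of length one or two there.
  inner-valency≥3 : ∀ x → Inner x → (σ x ≢ x) × (σ (σ x) ≢ x)
  inner-valency≥3 = dart-elim _ (λ i inner-i → ⊥-elim (inner-i (i , refl))) (λ k _ → one-step k , two-steps k)
    where
    one-step : ∀ k → σ (inner k) ≢ inner k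
    one-step k e = prev≢ (pointOf k) (trans (sym (pointOf-innerAt _ (Big-prev (Big-pointOf k))))
                                        (cong pointOf (inner-injective (trans (sym (σ-inner k)) e))))
    two-steps : ∀ k → σ (σ (inner k)) ≢ inner k
    two-steps k e = Big-pointOf k (trans (sym (next-prev (prev i))) (cong next prev-prev-i))
      where
      i = pointOf k
      bppi = Big-prev (Big-prev (Big-pointOf k))
      prev-prev-i : prev (prev i) ≡ i
      prev-prev-i = trans (sym (pointOf-innerAt _ bppi))
        (cong pointOf (inner-injective (trans (sym (trans (cong σ (σ-inner k)) (σ-innerAt (prev i) _ bppi))) e)))

  DiagAdj : Fin D → Fin D → Set
  DiagAdj x y = (y ≡ ι x) ⊎ (Inner x × (y ≡ σ x))

  -- The boundary point a dart belongs to (for an inner dart: the point it is joined to).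
  pointOfDart : Fin D → Fin N
  pointOfDart = caseDart (λ i → i) pointOf

  pointOfDart-boundary : ∀ i → pointOfDart (boundary i) ≡ i
  pointOfDart-boundary = caseDart-boundary _ _

  pointOfDart-inner : ∀ k → pointOfDart (inner k) ≡ pointOf k
  pointOfDart-inner = caseDart-inner _ _

  pointOfDart-innerAt : ∀ i .(big : Big i) → pointOfDart (inner (innerAt i big)) ≡ i
  pointOfDart-innerAt i big = trans (pointOfDart-inner _) (pointOf-innerAt i big)

  R-ι : ∀ x → R (pointOfDart x) (pointOfDart (ι x))
  R-ι = dart-elim _ onBoundary onInner
    where
    onBoundary : ∀ i → R (pointOfDart (boundary i)) (pointOfDart (ι (boundary i)))
    onBoundary i with Big? i
    ... | yes big  = subst₂ R (sym (pointOfDart-boundary i))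
                       (sym (trans (cong pointOfDart (ι-boundary-big i big)) (pointOfDart-innerAt i big))) R-refl
    ... | no small = subst₂ R (sym (pointOfDart-boundary i))
                       (sym (trans (cong pointOfDart (ι-boundary-small i small)) (pointOfDart-boundary (prev i)))) (R-sym (R-prev i))
    onInner : ∀ k → R (pointOfDart (inner k)) (pointOfDart (ι (inner k)))
    onInner k = subst₂ R (sym (pointOfDart-inner k))
                  (sym (trans (cong pointOfDart (ι-inner k)) (pointOfDart-boundary (pointOf k)))) R-refl

  R-σ-Inner : ∀ x → Inner x → R (pointOfDart x) (pointOfDart (σ x))
  R-σ-Inner = dart-elim _ (λ i inner-i → ⊥-elim (inner-i (i , refl))) λ k _ →
    subst₂ R (sym (pointOfDart-inner k)) (sym (trans (cong pointOfDart (σ-inner k)) (pointOfDart-innerAt _ _))) (R-sym (R-prev (pointOf k)))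

  DiagAdj-R : ∀ {x y} → DiagAdj x y → R (pointOfDart x) (pointOfDart y)
  DiagAdj-R {x} (inj₁ refl)             = R-ι x
  DiagAdj-R {x} (inj₂ (inner-x , refl)) = R-σ-Inner x inner-x

  DiagConnected-R : ∀ {x y} → Star DiagAdj x y → R (pointOfDart x) (pointOfDart y)
  DiagConnected-R ε            = R-refl
  DiagConnected-R (adj ◅ path) = R-trans (DiagAdj-R adj) (DiagConnected-R path)

  path-to-prev : ∀ i → Star DiagAdj (boundary i) (boundary (prev i))
  path-to-prev i with Big? i
  ... | yes big  = inj₁ (sym (ι-boundary-big i big))
                 ◅ inj₂ (Inner-inner _ , sym (σ-innerAt i big (Big-prev big)))
                 ◅ inj₁ (sym (ι-innerAt (prev i) (Big-prev big)))
                 ◅ ε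
  ... | no small = inj₁ (sym (ι-boundary-small i small)) ◅ ε

  path-iter-prev : ∀ t i → Star DiagAdj (boundary i) (boundary (iter prev t i))
  path-iter-prev zero    i = ε
  path-iter-prev (suc t) i = path-iter-prev t i ◅◅ path-to-prev (iter prev t i)

  α-correct : ∀ i j → R i j ⇔ Star DiagAdj (boundary i) (boundary j)
  α-correct i j = mk⇔ R⇒path (subst₂ R (pointOfDart-boundary i) (pointOfDart-boundary j) ∘ DiagConnected-R)
    where
    R⇒path : R i j → Star DiagAdj (boundary i) (boundary j)
    R⇒path Rij with prev-orbit-block Rij
    ... | t , refl = path-iter-prev t i

  σ-injective : ∀ {x y} → σ x ≡ σ y → x ≡ y
  σ-injective {x} {y} e = trans (sym (σ⁻¹-σ x)) (trans (cong σ⁻¹ e) (σ⁻¹-σ y))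

  ι-injective : ∀ {x y} → ι x ≡ ι y → x ≡ y
  ι-injective {x} {y} e = trans (sym (ι-ι x)) (trans (cong ι e) (ι-ι y))

  iter-σ-boundary : ∀ n i → iter σ n (boundary i) ≡ boundary (iter cyclicSucc n i)
  iter-σ-boundary = iter-natural σ cyclicSucc boundary σ-boundary

  iter-σ-inner : ∀ n k → iter σ n (inner k) ≡ inner (innerAt (iter prev n (pointOf k)) (Big-iter-prev n (Big-pointOf k)))
  iter-σ-inner zero    k = cong inner (sym (innerAt-pointOf k))
  iter-σ-inner (suc n) k = trans (cong σ (iter-σ-inner n k)) (σ-innerAt _ _ _)

  zero-σ-boundary : ∀ i → SameOrbit σ (boundary zero) (boundary i)
  zero-σ-boundary i = toℕ i , trans (iter-σ-boundary (toℕ i) zero) (cong boundary (iter-cyclicSucc-zero i))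

  -- The vertex at infinity is numbered zero, the inner vertex of a big block by the block's minimum.
  vertexOf : Fin D → Fin (suc #bigBlocks)
  vertexOf = caseDart (λ _ → zero) λ k → suc (index BigBlockMin? (blockMin (pointOf k)) (BigBlockMin-blockMin (Big-pointOf k)))

  vertexRep : Fin (suc #bigBlocks) → Fin D
  vertexRep zero    = boundary zero
  vertexRep (suc v) = inner (innerAt (element BigBlockMin? v) (proj₁ (element-satisfies BigBlockMin? v)))

  vertexOf-boundary : ∀ i → vertexOf (boundary i) ≡ zero
  vertexOf-boundary = caseDart-boundary _ _

  vertexOf-inner : ∀ k → vertexOf (inner k) ≡ suc (index BigBlockMin? (blockMin (pointOf k)) (BigBlockMin-blockMin (Big-pointOf k)))
  vertexOf-inner = caseDart-inner _ _

  vertexOf-innerAt : ∀ i .(big : Big i) →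
    vertexOf (inner (innerAt i big)) ≡ suc (index BigBlockMin? (blockMin i) (BigBlockMin-blockMin big))
  vertexOf-innerAt i big = trans (vertexOf-inner _) (cong suc (index-cong BigBlockMin? (cong blockMin (pointOf-innerAt i big))))

  vertexOf-vertexRep : ∀ v → vertexOf (vertexRep v) ≡ v
  vertexOf-vertexRep zero    = vertexOf-boundary zero
  vertexOf-vertexRep (suc v) = trans (vertexOf-innerAt (element BigBlockMin? v) _) (cong suc (trans
    (index-cong BigBlockMin? (blockMin-BigBlockMin (element-satisfies BigBlockMin? v)))
    (index-element BigBlockMin? v (element-satisfies BigBlockMin? v))))

  vertexOf-σ : ∀ x → vertexOf (σ x) ≡ vertexOf x
  vertexOf-σ = dart-elim _
    (λ i → trans (cong vertexOf (σ-boundary i)) (trans (vertexOf-boundary (cyclicSucc i)) (sym (vertexOf-boundary i))))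
    (λ k → trans (cong vertexOf (σ-inner k)) (trans (vertexOf-innerAt (prev (pointOf k)) _)
      (trans (cong suc (index-cong BigBlockMin? (blockMin-cong (R-prev (pointOf k))))) (sym (vertexOf-inner k)))))

  vertexRep-reached : ∀ x → SameOrbit σ x (vertexRep (vertexOf x))
  vertexRep-reached = dart-elim _ onBoundary onInner
    where
    onBoundary : ∀ i → SameOrbit σ (boundary i) (vertexRep (vertexOf (boundary i)))
    onBoundary i = subst (SameOrbit σ (boundary i) ∘ vertexRep) (sym (vertexOf-boundary i))
                         (SameOrbit-sym σ σ-injective (zero-σ-boundary i))
    onInner : ∀ k → SameOrbit σ (inner k) (vertexRep (vertexOf (inner k)))
    onInner k with prev-orbit-block (proj₁ (blockMin-least (pointOf k)))
    ... | n , e = n , trans (iter-σ-inner n k) (trans (cong inner (innerAt-cong (trans e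
      (sym (element-index BigBlockMin? _ (BigBlockMin-blockMin (Big-pointOf k)))))))
      (cong vertexRep (sym (vertexOf-inner k))))

  vertices : NumClasses (SameOrbit σ) (suc #bigBlocks)
  vertices = numClasses-SameOrbit σ σ-injective vertexOf vertexRep vertexOf-vertexRep vertexOf-σ vertexRep-reached

  φ′ : Fin D → Fin D
  φ′ = φ diagramMap

  φ′-injective : ∀ {x y} → φ′ x ≡ φ′ y → x ≡ y
  φ′-injective = ι-injective ∘ σ-injective

  -- Faces are numbered by their innermost arc, the outer face by zero.
  faceLabel : Maybe (Fin N) → Fin (suc #arcs)
  faceLabel nothing = zero
  faceLabel (just b) with ArcEnd? b
  ... | yes end = suc (index ArcEnd? b end)
  ... | no _    = zero

  faceLabel-ArcEnd : ∀ {b} (end : ArcEnd b) → faceLabel (just b) ≡ suc (index ArcEnd? b end)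
  faceLabel-ArcEnd {b} end with ArcEnd? b
  ... | yes _     = refl
  ... | no ¬end   = ⊥-elim (¬end end)

  gapFace : ℕ → Fin (suc #arcs)
  gapFace = faceLabel ∘ innermostArc

  faceOf : Fin D → Fin (suc #arcs)
  faceOf = caseDart (gapFace ∘ toℕ) (gapFace ∘ suc ∘ toℕ ∘ pointOf)

  faceOf-boundary : ∀ i → faceOf (boundary i) ≡ gapFace (toℕ i)
  faceOf-boundary = caseDart-boundary _ _

  faceOf-inner : ∀ k → faceOf (inner k) ≡ gapFace (suc (toℕ (pointOf k)))
  faceOf-inner = caseDart-inner _ _

  faceRep : Fin (suc #arcs) → Fin D
  faceRep zero    = boundary zero
  faceRep (suc a) = boundary (element ArcEnd? a)

  faceOf-faceRep : ∀ v → faceOf (faceRep v) ≡ v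
  faceOf-faceRep zero    = trans (faceOf-boundary zero) (cong faceLabel innermostArc-zero)
  faceOf-faceRep (suc a) = trans (faceOf-boundary (element ArcEnd? a)) (trans (cong faceLabel (innermostArc-ArcEnd end))
    (trans (faceLabel-ArcEnd end) (cong suc (index-element ArcEnd? a end))))
    where end = element-satisfies ArcEnd? a

  faceOf-φ′ : ∀ x → faceOf (φ′ x) ≡ faceOf x
  faceOf-φ′ = dart-elim _ onBoundary onInner
    where
    open ≡-Reasoning
    onBoundary : ∀ i → faceOf (φ′ (boundary i)) ≡ faceOf (boundary i)
    onBoundary i with Big? i
    ... | yes big = begin
      faceOf (σ (ι (boundary i)))                    ≡⟨ cong (faceOf ∘ σ) (ι-boundary-big i big) ⟩
      faceOf (σ (inner (innerAt i big)))             ≡⟨ cong faceOf (σ-innerAt i big (Big-prev big)) ⟩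
      faceOf (inner (innerAt (prev i) (Big-prev big))) ≡⟨ faceOf-inner (innerAt (prev i) (Big-prev big)) ⟩
      gapFace (suc (toℕ (pointOf (innerAt (prev i) (Big-prev big)))))
        ≡⟨ cong (gapFace ∘ suc ∘ toℕ) (pointOf-innerAt (prev i) (Big-prev big)) ⟩
      gapFace (suc (toℕ (prev i)))                   ≡⟨ cong faceLabel (innermostArc-prev i) ⟩
      gapFace (toℕ i)                                ≡⟨ faceOf-boundary i ⟨
      faceOf (boundary i)                            ∎
    ... | no small = begin
      faceOf (σ (ι (boundary i)))                    ≡⟨ cong (faceOf ∘ σ) (ι-boundary-small i small) ⟩
      faceOf (σ (boundary (prev i)))                 ≡⟨ cong faceOf (σ-boundary (prev i)) ⟩
      faceOf (boundary (cyclicSucc (prev i)))        ≡⟨ faceOf-boundary (cyclicSucc (prev i)) ⟩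
      gapFace (toℕ (cyclicSucc (prev i)))            ≡⟨ cong faceLabel (innermostArc-cyclicSucc (prev i)) ⟩
      gapFace (suc (toℕ (prev i)))                   ≡⟨ cong faceLabel (innermostArc-prev i) ⟩
      gapFace (toℕ i)                                ≡⟨ faceOf-boundary i ⟨
      faceOf (boundary i)                            ∎
    onInner : ∀ k → faceOf (φ′ (inner k)) ≡ faceOf (inner k)
    onInner k = begin
      faceOf (σ (ι (inner k)))                       ≡⟨ cong (faceOf ∘ σ) (ι-inner k) ⟩
      faceOf (σ (boundary (pointOf k)))              ≡⟨ cong faceOf (σ-boundary (pointOf k)) ⟩
      faceOf (boundary (cyclicSucc (pointOf k)))     ≡⟨ faceOf-boundary (cyclicSucc (pointOf k)) ⟩
      gapFace (toℕ (cyclicSucc (pointOf k)))         ≡⟨ cong faceLabel (innermostArc-cyclicSucc (pointOf k)) ⟩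
      gapFace (suc (toℕ (pointOf k)))                ≡⟨ faceOf-inner k ⟨
      faceOf (inner k)                               ∎

  φ′-boundary : ∀ i → SameOrbit φ′ (boundary i) (boundary (cyclicSucc (prev i)))
  φ′-boundary i with Big? i
  ... | yes big  = 2 , trans (cong φ′ (trans (cong σ (ι-boundary-big i big)) (σ-innerAt i big (Big-prev big))))
                             (trans (cong σ (ι-innerAt (prev i) (Big-prev big))) (σ-boundary (prev i)))
  ... | no small = 1 , trans (cong σ (ι-boundary-small i small)) (σ-boundary (prev i))

  φ′-inner : ∀ k → SameOrbit φ′ (inner k) (boundary (cyclicSucc (pointOf k)))
  φ′-inner k = 1 , trans (cong σ (ι-inner k)) (σ-boundary (pointOf k))

  FaceRepReached : Fin D → Set
  FaceRepReached x = SameOrbit φ′ x (faceRep (faceOf x))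

  FaceRepReached-back : ∀ {x y} → SameOrbit φ′ x y → FaceRepReached y → FaceRepReached x
  FaceRepReached-back {x} {y} (n , refl) reached =
    SameOrbit-trans (n , refl) (subst (SameOrbit φ′ y ∘ faceRep) (iter-invariant φ′ faceOf faceOf-φ′ n x) reached)

  FaceRepReached-zero : FaceRepReached (boundary zero)
  FaceRepReached-zero = 0 , sym (cong faceRep (faceOf-faceRep zero))

  FaceRepReached-ArcEnd : ∀ {i} → ArcEnd i → FaceRepReached (boundary i)
  FaceRepReached-ArcEnd {i} end = 0 , sym (trans (cong faceRep label≡) (cong boundary (element-index ArcEnd? i end)))
    where
    label≡ : faceOf (boundary i) ≡ suc (index ArcEnd? i end)
    label≡ = trans (faceOf-boundary i) (trans (cong faceLabel (innermostArc-ArcEnd end)) (faceLabel-ArcEnd end))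

  -- From a boundary dart that is not an arc end, φ′ jumps past the arc starting there; the fuel bounds the number of jumps.
  FaceRepReached-boundary : ∀ fuel i → N ℕ.≤ toℕ i + fuel → FaceRepReached (boundary i)
  FaceRepReached-boundary zero       i N≤i = ⊥-elim (ℕ.<⇒≱ (Fin.toℕ<n i) (subst (N ℕ.≤_) (ℕ.+-identityʳ _) N≤i))
  FaceRepReached-boundary (suc fuel) i N≤i = byCases (ArcEnd? i) (i Fin.≟ zero)
    where
    afterArc : i < prev i → CyclicSucc (prev i) (cyclicSucc (prev i)) → FaceRepReached (boundary (cyclicSucc (prev i)))
    afterArc i<p (inj₁ e) = FaceRepReached-boundary fuel (cyclicSucc (prev i))
      (ℕ.≤-trans (subst (N ℕ.≤_) (ℕ.+-suc _ fuel) N≤i) (ℕ.+-monoˡ-≤ fuel i<next))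
      where
      i<next : toℕ i ℕ.< toℕ (cyclicSucc (prev i))
      i<next = ℕ.<-trans i<p (subst (toℕ (prev i) ℕ.<_) e (ℕ.n<1+n _))
    afterArc _   (inj₂ (_ , z)) = subst (FaceRepReached ∘ boundary) (sym (Fin.toℕ-injective z)) FaceRepReached-zero
    byCases : Dec (ArcEnd i) → Dec (i ≡ zero) → FaceRepReached (boundary i)
    byCases (yes end)  _          = FaceRepReached-ArcEnd end
    byCases (no _)     (yes refl) = FaceRepReached-zero
    byCases (no ¬end)  (no _)     = FaceRepReached-back (φ′-boundary i)
      (afterArc (≢∧≮⇒> (prev≢ i) ¬end) (cyclicSucc-CyclicSucc (prev i)))

  faceRep-reached : ∀ x → FaceRepReached x
  faceRep-reached = dart-elim _ (λ i → FaceRepReached-boundary N i (ℕ.m≤n+m N (toℕ i)))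
    (λ k → FaceRepReached-back (φ′-inner k) (FaceRepReached-boundary N _ (ℕ.m≤n+m N _)))

  faces : NumClasses (SameOrbit φ′) (suc #arcs)
  faces = numClasses-SameOrbit φ′ φ′-injective faceOf faceRep faceOf-faceRep faceOf-φ′ faceRep-reached

  connected-to-zero : ∀ x → MapConnected diagramMap x (boundary zero)
  connected-to-zero = dart-elim _ onBoundary (λ k → inj₂ (sym (ι-inner k)) ◅ onBoundary (pointOf k))
    where
    onBoundary : ∀ i → MapConnected diagramMap (boundary i) (boundary zero)
    onBoundary i = SameOrbit-σ⇒MapConnected diagramMap (SameOrbit-sym σ σ-injective (zero-σ-boundary i))

  connected-from-zero : ∀ x → MapConnected diagramMap (boundary zero) x
  connected-from-zero = dart-elim _ onBoundary λ k →
    onBoundary (pointOf k) ◅◅ inj₂ (trans (cong inner (sym (innerAt-pointOf k))) (sym (ι-boundary-big _ (Big-pointOf k)))) ◅ ε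
    where
    onBoundary : ∀ i → MapConnected diagramMap (boundary zero) (boundary i)
    onBoundary i = SameOrbit-σ⇒MapConnected diagramMap (zero-σ-boundary i)

  connected : NumClasses (MapConnected diagramMap) 1
  connected = (λ _ → zero) , (λ { zero → boundary zero , refl })
            , λ x y → mk⇔ (λ _ → connected-to-zero x ◅◅ connected-from-zero y) (λ _ → refl)

  planar : Planar diagramMap
  planar = suc #bigBlocks , suc #arcs , 1 , vertices , faces , connected , euler
    where
    euler : 2 * suc #bigBlocks + 2 * suc #arcs ≡ D + 4 * 1
    euler = trans (shift #bigBlocks #arcs) (cong (_+ 4 * 1) count-identity)
      where
      shift : ∀ a b → 2 * suc a + 2 * suc b ≡ ((a + a) + (b + b)) + 4 * 1
      shift = solve-∀

emptyDiagram : BDiagram 0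
emptyDiagram = record
  { cmap        = record { darts = 0 ; σ = λ () ; σ⁻¹ = λ () ; σ-inv₁ = λ () ; σ-inv₂ = λ ()
                         ; ι = λ () ; ι-invol = λ () ; ι-free = λ () }
  ; bd          = λ ()
  ; bd-inj      = λ { {()} }
  ; bd-rot      = λ ()
  ; planar      = 0 , 0 , 0 , none , none , none , refl
  ; noInnerEdge = λ ()
  ; valency≥3   = λ ()
  }
  where
  none : {R : Fin 0 → Fin 0 → Set} → NumClasses R 0
  none = (λ ()) , (λ ()) , (λ ())

mainTheorem7 : (n : ℕ) (R : Fin (2 * n) → Fin (2 * n) → Set) → IsP (2 * n) R →
    Σ (BDiagram n) λ b → ∀ i j → R i j ⇔ BDiagram.α b i j
mainTheorem7 zero    R _   = emptyDiagram , λ ()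
mainTheorem7 (suc m) R isP = diagram , α-correct
  where
  open Construction R isP
  diagram : BDiagram (suc m)
  diagram = record
    { cmap        = diagramMap
    ; bd          = boundary
    ; bd-inj      = boundary-injective
    ; bd-rot      = boundary-CyclicSucc
    ; planar      = planar
    ; noInnerEdge = no-inner-edge
    ; valency≥3   = inner-valency≥3
    }
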